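{- For every integer $m\ge 0$, the generating function $F_m(x)=\sum_{n\ge0}b(n,m)x^n$ satisfies, as formal power series, $$F_m(x)=\frac{Q_m(-x)}{Q_{m+1}(x)}.$$
   Context: For a positive integer $m$, $B(m)=(b_{ij})_{1\le i,j\le m}$ is the $m\times m$ matrix with $b_{ij}=1$ if $i+j\le m+1$ and $0$ otherwise. For a square matrix $A$, $s(A)$ is the sum of all its entries. Define $b(n,m)$ for $n,m\ge0$ by $b(n,m)=1$ if $n=0$ or $m=0$, and $b(n,m)=s\big(B(m+1)^{n-1}\big)$ if $n,m\ge1$. Let $Q_0(x)=1$ and $Q_m(x)=\det(I_m-xB(m))$ for $m\ge1$. -}

module Defs where

open import Data.Nat as ℕ using (ℕ; zero; suc; _∸_; _<ᵇ_)
open import Data.Bool using (if_then_else_)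
open import Data.Integer as ℤ using (ℤ; +_; -_)
open import Data.Fin using (Fin; toℕ; punchIn)
import Data.Fin as Fin

sumℕ : ∀ n → (Fin n → ℕ) → ℕ
sumℕ zero    f = 0
sumℕ (suc n) f = f Fin.zero ℕ.+ sumℕ n (λ i → f (Fin.suc i))

sumℤ : ∀ n → (Fin n → ℤ) → ℤ
sumℤ zero    f = + 0
sumℤ (suc n) f = f Fin.zero ℤ.+ sumℤ n (λ i → f (Fin.suc i))

sumUpTo : ℕ → (ℕ → ℤ) → ℤ
sumUpTo zero    f = f 0
sumUpTo (suc n) f = sumUpTo n f ℤ.+ f (suc n)

Mat : ℕ → Set
Mat m = Fin m → Fin m → ℕ

-- B(m): b_ij = 1 iff i + j ≤ m + 1 (1-based), i.e. i' + j' < m (0-based)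
B : ∀ m → Mat m
B m i j = if (toℕ i ℕ.+ toℕ j) <ᵇ m then 1 else 0

idMat : ∀ m → Mat m
idMat m i j = if toℕ i ℕ.≡ᵇ toℕ j then 1 else 0

_⊗_ : ∀ {m} → Mat m → Mat m → Mat m
_⊗_ {m} A C i j = sumℕ m (λ k → A i k ℕ.* C k j)

matPow : ∀ {m} → Mat m → ℕ → Mat m
matPow {m} A zero    = idMat m
matPow {m} A (suc k) = matPow A k ⊗ A

s : ∀ {m} → Mat m → ℕ
s {m} A = sumℕ m (λ i → sumℕ m (λ j → A i j))

b : ℕ → ℕ → ℕ
b zero    m       = 1
b (suc n) zero    = 1
b (suc k) (suc m) = s (matPow (B (suc (suc m))) k)

Series : Set
Series = ℕ → ℤ

_⊕_ : Series → Series → Series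
(f ⊕ g) n = f n ℤ.+ g n

_⊛_ : Series → Series → Series
(f ⊛ g) n = sumUpTo n (λ k → f k ℤ.* g (n ∸ k))

constS : ℤ → Series
constS c zero    = c
constS c (suc n) = + 0

oneS : Series
oneS = constS (+ 1)

X : Series
X zero          = + 0
X (suc zero)    = + 1
X (suc (suc n)) = + 0

negS : Series → Series
negS f n = - f n

sumS : ∀ n → (Fin n → Series) → Series
sumS zero    f = constS (+ 0)
sumS (suc n) f = f Fin.zero ⊕ sumS n (λ i → f (Fin.suc i))

sign : ℕ → ℤ
sign zero    = + 1
sign (suc k) = - sign k

det : ∀ n → (Fin n → Fin n → Series) → Series
det zero    M = oneS
det (suc n) M = sumS (suc n) (λ j →
  (constS (sign (toℕ j)) ⊛ M Fin.zero j) ⊛ det n (λ i k → M (Fin.suc i) (punchIn j k)))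

Q : ℕ → Series
Q zero    = oneS
Q (suc m) = det (suc m) (λ i j →
  constS (+ idMat (suc m) i j) ⊕ negS (constS (+ B (suc m) i j) ⊛ X))

-- Q_m(-x): coefficientwise substitution x ↦ -x
Qneg : ℕ → Series
Qneg m n = sign n ℤ.* Q m n

F : ℕ → Series
F m n = + b n m

{-# OPTIONS --safe #-}

-- Let B = B(m+1) and A = I - xB over ℤ[[x]], so that Q_{m+1}(x) = det A. The n-th power
-- of B has entry sum b(n+1, m), so with the row vector w = 1ᵀA⁻¹ we get F_m = 1 + x w 1.
-- Consider the bordered matrix G = [[1, 1ᵀ], [-x1, A]]. Adding x w_c times column c+1 to
-- column 0 clears it below the corner, so det G = F_m det A. Subtracting column 0 from the
-- other columns instead gives det G = det(A + xJ) = det(I + x(J - B)). The first row of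
-- J - B is zero and its remaining block is B(m) with rows and columns reversed, hence
-- det(I + x(J - B)) = det(I + xB(m)) = Q_m(-x).

module Submission where

open import Algebra.Bundles using (CommutativeRing)
open import Algebra.Morphism.Structures using (IsRingHomomorphism)
import Algebra.Properties.Semiring.Sum as SemiringSum
open import Algebra.Structures using (IsCommutativeRing)
open import Data.Bool using (true; false; not; if_then_else_)
open import Data.Empty using (⊥-elim)
open import Data.Fin as Fin using (Fin; zero; suc; toℕ; punchIn; opposite)
import Data.Fin.Properties as Finₚ
open import Data.Integer as ℤ using (ℤ; +_)
import Data.Integer.Properties as ℤₚ
import Data.Integer.Tactic.RingSolver as ℤ-Solver
open import Data.Nat as ℕ using (ℕ; zero; suc; _∸_; _≤_; z≤n; _<ᵇ_)
import Data.Nat.Properties as ℕₚ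
import Data.Nat.Tactic.RingSolver as ℕ-Solver
open import Data.Product using (_,_)
open import Data.Vec.Functional using (updateAt; tail)
import Data.Vec.Functional.Properties as Vecₚ
open import Function using (_∘_)
open import Level using (0ℓ)
import Relation.Binary.PropositionalEquality as ≡
open import Relation.Nullary using (¬_; yes; no)
import Relation.Nullary.Reflects as Reflects

open import Defs hiding (det)

module Determinant {a ℓ} (R : CommutativeRing a ℓ) where

  open CommutativeRing R hiding (zero)
  open import Algebra.Properties.Ring ring using (-‿distribˡ-*; -‿distribʳ-*; -‿involutive; -1*x≈-x)
  open import Algebra.Solver.Ring.NaturalCoefficients.Default commutativeSemiring
    using (solve; _:=_; _:*_)
  open import Relation.Binary.Reasoning.Setoid setoid

  private module Sum = SemiringSum semiring

  -- Opaque, so that a sum over Fin (suc n) is not unfolded while solving unification problems.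
  opaque
    ∑ : ∀ {n} → (Fin n → Carrier) → Carrier
    ∑ = Sum.sum

  opaque
    unfolding ∑

    ∑-cong : ∀ {n} {f g : Fin n → Carrier} → (∀ i → f i ≈ g i) → ∑ f ≈ ∑ g
    ∑-cong = Sum.sum-cong-≋

    ∑-suc : ∀ {n} (f : Fin (suc n) → Carrier) → ∑ f ≈ f zero + ∑ (f ∘ suc)
    ∑-suc f = refl

    ∑-zero : ∀ {n} {f : Fin n → Carrier} → (∀ i → f i ≈ 0#) → ∑ f ≈ 0#
    ∑-zero {n} f≈0 = trans (Sum.sum-cong-≋ f≈0) (Sum.sum-replicate-zero n)

    *-distribˡ-∑ : ∀ {n} x (f : Fin n → Carrier) → x * ∑ f ≈ ∑ (λ i → x * f i)
    *-distribˡ-∑ = Sum.*-distribˡ-sum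

    ∑-comm : ∀ {m n} (f : Fin m → Fin n → Carrier) → ∑ (λ i → ∑ (f i)) ≈ ∑ (λ j → ∑ (λ i → f i j))
    ∑-comm = Sum.∑-comm

    ∑-distrib-+ : ∀ {n} (f g : Fin n → Carrier) → ∑ (λ i → f i + g i) ≈ ∑ f + ∑ g
    ∑-distrib-+ = Sum.∑-distrib-+

    ∑-remove : ∀ {n} (i : Fin (suc n)) (f : Fin (suc n) → Carrier) → ∑ f ≈ f i + ∑ (f ∘ punchIn i)
    ∑-remove i = Sum.sum-remove

  ∑-neg : ∀ {n} (f : Fin n → Carrier) → ∑ (λ i → - f i) ≈ - ∑ f
  ∑-neg f = trans (∑-cong λ i → sym (-1*x≈-x (f i))) (trans (sym (*-distribˡ-∑ (- 1#) f)) (-1*x≈-x _))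

  Matrix : ℕ → Set a
  Matrix n = Fin n → Fin n → Carrier

  sgn : ℕ → Carrier
  sgn zero    = 1#
  sgn (suc k) = - sgn k

  minor : ∀ {n} → Fin (suc n) → Matrix (suc n) → Matrix n
  minor j M a b = M (suc a) (punchIn j b)

  det : ∀ n → Matrix n → Carrier
  det zero    M = 1#
  det (suc n) M = ∑ λ j → (sgn (toℕ j) * M zero j) * det n (minor j M)

  neg-*ˡ : ∀ x y → (- x) * y ≈ - (x * y)
  neg-*ˡ x y = sym (-‿distribˡ-* x y)

  neg-*-neg : ∀ x y → (- x) * (- y) ≈ x * y
  neg-*-neg x y = trans (neg-*ˡ x (- y)) (trans (-‿cong (sym (-‿distribʳ-* x y))) (-‿involutive _))

  sgn-sq : ∀ k → sgn k * sgn k ≈ 1#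
  sgn-sq zero    = *-identityˡ 1#
  sgn-sq (suc k) = trans (neg-*-neg (sgn k) (sgn k)) (sgn-sq k)

  sgn-cancel : ∀ k x → sgn k * (sgn k * x) ≈ x
  sgn-cancel k x = trans (sym (*-assoc _ _ x)) (trans (*-congʳ (sgn-sq k)) (*-identityˡ x))

  det-cong : ∀ n {M M′ : Matrix n} → (∀ i j → M i j ≈ M′ i j) → det n M ≈ det n M′
  det-cong zero    M≈M′ = refl
  det-cong (suc n) M≈M′ = ∑-cong λ j →
    *-cong (*-congˡ (M≈M′ zero j)) (det-cong n λ a b → M≈M′ (suc a) (punchIn j b))

  colMinor : ∀ {n} → Fin (suc n) → Matrix (suc n) → Matrix n
  colMinor i M a b = M (punchIn i a) (suc b)

  det-expandCol₀ : ∀ n (M : Matrix (suc n)) →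
                   det (suc n) M ≈ ∑ λ i → (sgn (toℕ i) * M i zero) * det n (colMinor i M)
  det-expandCol₀ zero    M = ∑-cong λ { zero → refl }
  det-expandCol₀ (suc n) M = begin
      ∑ (λ j → (sgn (toℕ j) * M zero j) * det (suc n) (minor j M))
    ≈⟨ ∑-suc _ ⟩
      (1# * M zero zero) * det (suc n) (minor zero M) + ∑ (λ k → r k * det (suc n) (minor (suc k) M))
    ≈⟨ +-congˡ (∑-cong λ k → *-congˡ (det-expandCol₀ n (minor (suc k) M))) ⟩
      _ + ∑ (λ k → r k * ∑ λ i → (sgn (toℕ i) * M (suc i) zero) * D i k)
    ≈⟨ +-congˡ (∑-cong λ k → *-distribˡ-∑ (r k) _) ⟩
      _ + ∑ (λ k → ∑ λ i → r k * ((sgn (toℕ i) * M (suc i) zero) * D i k))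
    ≈⟨ +-congˡ (∑-comm _) ⟩
      _ + ∑ (λ i → ∑ λ k → r k * ((sgn (toℕ i) * M (suc i) zero) * D i k))
    ≈⟨ +-congˡ (∑-cong λ i → ∑-cong λ k → swap-signs (sgn (toℕ k)) _ (sgn (toℕ i)) _ (D i k)) ⟩
      _ + ∑ (λ i → ∑ λ k → q i * ((sgn (toℕ k) * M zero (suc k)) * D i k))
    ≈⟨ +-congˡ (∑-cong λ i → *-distribˡ-∑ (q i) _) ⟨
      (1# * M zero zero) * det (suc n) (colMinor zero M) + ∑ (λ i → q i * det (suc n) (colMinor (suc i) M))
    ≈⟨ ∑-suc _ ⟨
      ∑ (λ i → (sgn (toℕ i) * M i zero) * det (suc n) (colMinor i M)) ∎
    where
    r q : Fin (suc n) → Carrier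
    r k = sgn (suc (toℕ k)) * M zero (suc k)
    q i = sgn (suc (toℕ i)) * M (suc i) zero
    D : Fin (suc n) → Fin (suc n) → Carrier
    D i k = det n λ a b → M (suc (punchIn i a)) (suc (punchIn k b))
    neg-** : ∀ p x y → ((- p) * x) * y ≈ - ((p * x) * y)
    neg-** p x y = trans (*-congʳ (neg-*ˡ p x)) (neg-*ˡ _ y)
    swap-signs : ∀ p x q y d → ((- p) * x) * ((q * y) * d) ≈ ((- q) * y) * ((p * x) * d)
    swap-signs p x q y d = trans (neg-** p x _) (trans (-‿cong (solve 5
      (λ p x q y d → (p :* x) :* ((q :* y) :* d) := (q :* y) :* ((p :* x) :* d)) refl p x q y d))
      (sym (neg-** q y _)))

  _ᵀ : ∀ {n} → Matrix n → Matrix n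
  (M ᵀ) i j = M j i

  det-ᵀ : ∀ n (M : Matrix n) → det n (M ᵀ) ≈ det n M
  det-ᵀ zero    M = refl
  det-ᵀ (suc n) M = trans (∑-cong λ i → *-congˡ (det-ᵀ n (colMinor i M))) (sym (det-expandCol₀ n M))

  det-firstRow : ∀ n (M : Matrix (suc n)) → (∀ j → M zero (suc j) ≈ 0#) →
                 det (suc n) M ≈ M zero zero * det n (minor zero M)
  det-firstRow n M row≈0 = begin
      det (suc n) M
    ≈⟨ ∑-suc _ ⟩
      (1# * M zero zero) * det n (minor zero M) + ∑ (λ j → (sgn (suc (toℕ j)) * M zero (suc j)) * _)
    ≈⟨ +-cong (*-congʳ (*-identityˡ _))
              (∑-zero λ j → trans (*-congʳ (trans (*-congˡ (row≈0 j)) (zeroʳ _))) (zeroˡ _)) ⟩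
      M zero zero * det n (minor zero M) + 0#
    ≈⟨ +-identityʳ _ ⟩
      M zero zero * det n (minor zero M) ∎

  det-firstCol : ∀ n (M : Matrix (suc n)) → (∀ i → M (suc i) zero ≈ 0#) →
                 det (suc n) M ≈ M zero zero * det n (minor zero M)
  det-firstCol n M col≈0 = begin
    det (suc n) M                           ≈⟨ det-ᵀ (suc n) M ⟨
    det (suc n) (M ᵀ)                       ≈⟨ det-firstRow n (M ᵀ) col≈0 ⟩
    M zero zero * det n (minor zero M ᵀ)    ≈⟨ *-congˡ (det-ᵀ n (minor zero M)) ⟩
    M zero zero * det n (minor zero M)      ∎

  det-col₀≈col₁ : ∀ n (M : Matrix (suc (suc n))) → (∀ i → M i zero ≈ M i (suc zero)) →
                  det (suc (suc n)) M ≈ 0#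
  later-terms-vanish : ∀ n (M : Matrix (suc (suc n))) → (∀ i → M i zero ≈ M i (suc zero)) →
                       (x : Fin n → Carrier) → ∑ (λ j → x j * det (suc n) (minor (suc (suc j)) M)) ≈ 0#

  det-col₀≈col₁ n M col₀≈col₁ = begin
      det (suc (suc n)) M
    ≈⟨ trans (∑-suc _) (+-congˡ (∑-suc _)) ⟩
      t₀ + (t₁ + _)
    ≈⟨ +-assoc t₀ t₁ _ ⟨
      (t₀ + t₁) + _
    ≈⟨ +-cong t₀+t₁≈0 (later-terms-vanish n M col₀≈col₁ _) ⟩
      0# + 0#
    ≈⟨ +-identityˡ 0# ⟩
      0# ∎
    where
    t₀ t₁ : Carrier
    t₀ = (1# * M zero zero) * det (suc n) (minor zero M)
    t₁ = (- 1# * M zero (suc zero)) * det (suc n) (minor (suc zero) M)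
    minor₁≈minor₀ : ∀ a b → minor (suc zero) M a b ≈ minor zero M a b
    minor₁≈minor₀ a zero    = col₀≈col₁ (suc a)
    minor₁≈minor₀ a (suc b) = refl
    t₀+t₁≈0 : t₀ + t₁ ≈ 0#
    t₀+t₁≈0 = begin
        t₀ + t₁
      ≈⟨ +-congˡ (*-cong (*-congˡ (sym (col₀≈col₁ zero))) (det-cong (suc n) minor₁≈minor₀)) ⟩
        t₀ + (- 1# * M zero zero) * det (suc n) (minor zero M)
      ≈⟨ +-congˡ (trans (*-congʳ (neg-*ˡ _ _)) (neg-*ˡ _ _)) ⟩
        t₀ - t₀
      ≈⟨ -‿inverseʳ t₀ ⟩
        0# ∎

  later-terms-vanish zero    M _         x = ∑-zero λ ()
  later-terms-vanish (suc n) M col₀≈col₁ x = ∑-zero λ j →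
    trans (*-congˡ (det-col₀≈col₁ n (minor (suc (suc j)) M) (col₀≈col₁ ∘ suc))) (zeroʳ _)

  toFront : ∀ {n} → Fin (suc n) → Fin (suc n) → Fin (suc n)
  toFront t zero    = t
  toFront t (suc b) = punchIn t b

  -- relPos t k is the position of column t in the minor that deletes column punchIn t k.
  relPos : ∀ {n} → Fin (suc (suc n)) → Fin (suc n) → Fin (suc n)
  relPos zero    k               = zero
  relPos (suc t) zero            = t
  relPos {suc n} (suc t) (suc k) = suc (relPos t k)

  toFront-punchIn : ∀ {n} (t : Fin (suc (suc n))) k b →
                    toFront t (punchIn (suc k) b) ≡.≡ punchIn (punchIn t k) (toFront (relPos t k) b)
  toFront-punchIn zero    k       zero    = ≡.refl
  toFront-punchIn zero    k       (suc b) = ≡.refl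
  toFront-punchIn (suc t) zero    zero    = ≡.refl
  toFront-punchIn (suc t) zero    (suc b) = ≡.refl
  toFront-punchIn {suc n} (suc t) (suc k) zero          = ≡.cong suc (toFront-punchIn t k zero)
  toFront-punchIn {suc n} (suc t) (suc k) (suc zero)    = ≡.refl
  toFront-punchIn {suc n} (suc t) (suc k) (suc (suc b)) = ≡.cong suc (toFront-punchIn t k (suc b))

  sgn-relPos : ∀ {n} (t : Fin (suc (suc n))) k →
               sgn (suc (toℕ k)) * sgn (toℕ (relPos t k)) ≈ sgn (toℕ t) * sgn (toℕ (punchIn t k))
  sgn-relPos zero    k       = *-comm _ _
  sgn-relPos (suc t) zero    = trans (neg-*ˡ 1# _) (trans (-‿cong (*-comm 1# _)) (sym (neg-*ˡ _ 1#)))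
  sgn-relPos {suc n} (suc t) (suc k) =
    trans (neg-*-neg _ _) (trans (sgn-relPos t k) (sym (neg-*-neg _ _)))

  det-toFront : ∀ n (t : Fin (suc n)) (M : Matrix (suc n)) →
                det (suc n) (λ i j → M i (toFront t j)) ≈ sgn (toℕ t) * det (suc n) M
  det-toFront-term : ∀ n (t : Fin (suc n)) (M : Matrix (suc n)) (k : Fin n) →
    (sgn (suc (toℕ k)) * M zero (punchIn t k)) * det n (minor (suc k) λ i j → M i (toFront t j))
      ≈ sgn (toℕ t) * ((sgn (toℕ (punchIn t k)) * M zero (punchIn t k)) * det n (minor (punchIn t k) M))

  det-toFront n t M = begin
      det (suc n) (λ i j → M i (toFront t j))
    ≈⟨ ∑-suc _ ⟩
      (1# * M zero t) * det n (minor t M) + ∑ (λ k → _)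
    ≈⟨ +-cong front-term (∑-cong (det-toFront-term n t M)) ⟩
      sgn (toℕ t) * T t + ∑ (λ k → sgn (toℕ t) * T (punchIn t k))
    ≈⟨ +-congˡ (*-distribˡ-∑ _ _) ⟨
      sgn (toℕ t) * T t + sgn (toℕ t) * ∑ (T ∘ punchIn t)
    ≈⟨ distribˡ _ _ _ ⟨
      sgn (toℕ t) * (T t + ∑ (T ∘ punchIn t))
    ≈⟨ *-congˡ (∑-remove t T) ⟨
      sgn (toℕ t) * det (suc n) M ∎
    where
    T : Fin (suc n) → Carrier
    T j = (sgn (toℕ j) * M zero j) * det n (minor j M)
    front-term : (1# * M zero t) * det n (minor t M) ≈ sgn (toℕ t) * T t
    front-term = begin
      (1# * M zero t) * det n (minor t M)                          ≈⟨ *-congʳ (*-congʳ (sgn-sq (toℕ t))) ⟨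
      ((sgn (toℕ t) * sgn (toℕ t)) * M zero t) * det n (minor t M) ≈⟨ trans (*-congʳ (*-assoc _ _ _)) (*-assoc _ _ _) ⟩
      sgn (toℕ t) * T t                                            ∎

  det-toFront-term (suc n) t M k = begin
      (sgn (suc (toℕ k)) * M zero j) * det (suc n) (minor (suc k) λ i j → M i (toFront t j))
    ≈⟨ *-congˡ (det-cong (suc n) λ a b → reflexive (≡.cong (M (suc a)) (toFront-punchIn t k b))) ⟩
      (sgn (suc (toℕ k)) * M zero j) * det (suc n) (λ a b → minor j M a (toFront (relPos t k) b))
    ≈⟨ *-congˡ (det-toFront n (relPos t k) (minor j M)) ⟩
      (sgn (suc (toℕ k)) * M zero j) * (sgn (toℕ (relPos t k)) * det (suc n) (minor j M))
    ≈⟨ solve 4 (λ s m r d → (s :* m) :* (r :* d) := (s :* r) :* (m :* d)) refl _ _ _ _ ⟩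
      (sgn (suc (toℕ k)) * sgn (toℕ (relPos t k))) * (M zero j * det (suc n) (minor j M))
    ≈⟨ *-congʳ (sgn-relPos t k) ⟩
      (sgn (toℕ t) * sgn (toℕ j)) * (M zero j * det (suc n) (minor j M))
    ≈⟨ solve 4 (λ s r m d → (s :* r) :* (m :* d) := s :* ((r :* m) :* d)) refl _ _ _ _ ⟩
      sgn (toℕ t) * ((sgn (toℕ j) * M zero j) * det (suc n) (minor j M)) ∎
    where
    j = punchIn t k

  det-fromFront : ∀ n (t : Fin (suc n)) (M : Matrix (suc n)) →
                  det (suc n) M ≈ sgn (toℕ t) * det (suc n) (λ i j → M i (toFront t j))
  det-fromFront n t M = sym (trans (*-congˡ (det-toFront n t M)) (sgn-cancel (toℕ t) _))

  det-col₀≈col : ∀ n (M : Matrix (suc (suc n))) (t : Fin (suc n)) → (∀ i → M i zero ≈ M i (suc t)) →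
                 det (suc (suc n)) M ≈ 0#
  det-col₀≈col n M t col₀≈col = begin
    det (suc (suc n)) M                                          ≈⟨ det-fromFront (suc n) (suc t) M ⟩
    sgn (suc (toℕ t)) * det (suc (suc n)) (λ i j → M i (toFront (suc t) j))
      ≈⟨ *-congˡ (det-col₀≈col₁ n (λ i j → M i (toFront (suc t) j)) λ i → sym (col₀≈col i)) ⟩
    sgn (suc (toℕ t)) * 0#                                       ≈⟨ zeroʳ _ ⟩
    0#                                                           ∎

  setCol₀ : ∀ {n} → Matrix (suc n) → (Fin (suc n) → Carrier) → Matrix (suc n)
  setCol₀ M u i zero    = u i
  setCol₀ M u i (suc b) = M i (suc b)

  det-setCol₀ : ∀ n (M : Matrix (suc n)) u →
                det (suc n) (setCol₀ M u) ≈ ∑ λ i → (sgn (toℕ i) * u i) * det n (colMinor i M)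
  det-setCol₀ n M u = det-expandCol₀ n (setCol₀ M u)

  det-setCol₀-col : ∀ n (M : Matrix (suc n)) (c : Fin n) → det (suc n) (setCol₀ M λ i → M i (suc c)) ≈ 0#
  det-setCol₀-col (suc n) M c = det-col₀≈col n (setCol₀ M λ i → M i (suc c)) c λ i → refl

  det-setCol₀-linear : ∀ n {k} (M : Matrix (suc n)) u (x : Fin k → Carrier) (U : Fin k → Fin (suc n) → Carrier) →
                       det (suc n) (setCol₀ M λ i → u i + ∑ λ c → x c * U c i) ≈
                       det (suc n) (setCol₀ M u) + ∑ λ c → x c * det (suc n) (setCol₀ M (U c))
  det-setCol₀-linear n M u x U = begin
      det (suc n) (setCol₀ M λ i → u i + ∑ λ c → x c * U c i)
    ≈⟨ det-setCol₀ n M _ ⟩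
      ∑ (λ i → (sgn (toℕ i) * (u i + ∑ λ c → x c * U c i)) * D i)
    ≈⟨ ∑-cong (λ i → trans (trans (*-congʳ (distribˡ _ _ _)) (distribʳ _ _ _)) (+-congˡ (pull-out i))) ⟩
      ∑ (λ i → (sgn (toℕ i) * u i) * D i + ∑ λ c → x c * ((sgn (toℕ i) * U c i) * D i))
    ≈⟨ ∑-distrib-+ _ _ ⟩
      ∑ (λ i → (sgn (toℕ i) * u i) * D i) + ∑ (λ i → ∑ λ c → x c * ((sgn (toℕ i) * U c i) * D i))
    ≈⟨ +-cong (sym (det-setCol₀ n M u)) (∑-comm _) ⟩
      det (suc n) (setCol₀ M u) + ∑ (λ c → ∑ λ i → x c * ((sgn (toℕ i) * U c i) * D i))
    ≈⟨ +-congˡ (∑-cong λ c → trans (sym (*-distribˡ-∑ (x c) _)) (*-congˡ (sym (det-setCol₀ n M (U c))))) ⟩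
      det (suc n) (setCol₀ M u) + ∑ (λ c → x c * det (suc n) (setCol₀ M (U c))) ∎
    where
    D : Fin (suc n) → Carrier
    D i = det n (colMinor i M)
    pull-out : ∀ i → (sgn (toℕ i) * ∑ (λ c → x c * U c i)) * D i ≈ ∑ λ c → x c * ((sgn (toℕ i) * U c i) * D i)
    pull-out i = begin
      (sgn (toℕ i) * ∑ (λ c → x c * U c i)) * D i   ≈⟨ solve 3 (λ s σ d → (s :* σ) :* d := (d :* s) :* σ) refl _ _ _ ⟩
      (D i * sgn (toℕ i)) * ∑ (λ c → x c * U c i)   ≈⟨ *-distribˡ-∑ _ _ ⟩
      ∑ (λ c → (D i * sgn (toℕ i)) * (x c * U c i))
        ≈⟨ ∑-cong (λ c → solve 4 (λ d s x m → (d :* s) :* (x :* m) := x :* ((s :* m) :* d)) refl _ _ _ _) ⟩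
      ∑ (λ c → x c * ((sgn (toℕ i) * U c i) * D i)) ∎

  det-addToCol₀ : ∀ n (M : Matrix (suc n)) (x : Fin n → Carrier) →
                  det (suc n) (setCol₀ M λ i → M i zero + ∑ λ c → x c * M i (suc c)) ≈ det (suc n) M
  det-addToCol₀ n M x = begin
      det (suc n) (setCol₀ M λ i → M i zero + ∑ λ c → x c * M i (suc c))
    ≈⟨ det-setCol₀-linear n M (λ i → M i zero) x (λ c i → M i (suc c)) ⟩
      det (suc n) (setCol₀ M λ i → M i zero) + ∑ (λ c → x c * det (suc n) (setCol₀ M λ i → M i (suc c)))
    ≈⟨ +-cong (det-cong (suc n) unchanged) (∑-zero λ c → trans (*-congˡ (det-setCol₀-col n M c)) (zeroʳ _)) ⟩
      det (suc n) M + 0#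
    ≈⟨ +-identityʳ _ ⟩
      det (suc n) M ∎
    where
    unchanged : ∀ i j → setCol₀ M (λ i → M i zero) i j ≈ M i j
    unchanged i zero    = refl
    unchanged i (suc _) = refl

  addCol₀Multiples : ∀ {n} → Matrix (suc n) → (Fin n → Carrier) → Matrix (suc n)
  addCol₀Multiples M x i zero    = M i zero
  addCol₀Multiples M x i (suc c) = M i (suc c) + x c * M i zero

  det-addCol₀Multiple-at : ∀ n (M : Matrix (suc (suc n))) (x : Fin (suc n) → Carrier) (t : Fin (suc n)) →
                           (∀ b → x (punchIn t b) ≈ 0#) → det (suc (suc n)) (addCol₀Multiples M x) ≈ det (suc (suc n)) M
  det-addCol₀Multiple-at n M x t x≈0 = begin
      det (suc (suc n)) (addCol₀Multiples M x)
    ≈⟨ det-fromFront (suc n) (suc t) (addCol₀Multiples M x) ⟩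
      sgn (suc (toℕ t)) * det (suc (suc n)) (λ i j → addCol₀Multiples M x i (toFront (suc t) j))
    ≈⟨ *-congˡ (det-cong (suc (suc n)) rotated) ⟩
      sgn (suc (toℕ t)) * det (suc (suc n)) (setCol₀ K λ i → K i zero + ∑ λ c → e c * K i (suc c))
    ≈⟨ *-congˡ (det-addToCol₀ (suc n) K e) ⟩
      sgn (suc (toℕ t)) * det (suc (suc n)) K
    ≈⟨ *-congˡ (det-toFront (suc n) (suc t) M) ⟩
      sgn (suc (toℕ t)) * (sgn (suc (toℕ t)) * det (suc (suc n)) M)
    ≈⟨ sgn-cancel (suc (toℕ t)) _ ⟩
      det (suc (suc n)) M ∎
    where
    K : Matrix (suc (suc n))
    K i j = M i (toFront (suc t) j)
    e : Fin (suc n) → Carrier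
    e zero    = x t
    e (suc _) = 0#
    rotated : ∀ i j → addCol₀Multiples M x i (toFront (suc t) j) ≈
                      setCol₀ K (λ i → K i zero + ∑ λ c → e c * K i (suc c)) i j
    rotated i zero          = +-congˡ (sym (trans (∑-suc _) (trans (+-congˡ (∑-zero λ _ → zeroˡ _)) (+-identityʳ _))))
    rotated i (suc zero)    = refl
    rotated i (suc (suc b)) = trans (+-congˡ (trans (*-congʳ (x≈0 b)) (zeroˡ _))) (+-identityʳ _)

  updateAt-split : ∀ {n} (x : Fin n → Carrier) t c →
                  x c ≈ updateAt x t (λ _ → 0#) c + updateAt (λ _ → 0#) t (λ _ → x t) c
  updateAt-split x zero    zero    = sym (+-identityˡ _)
  updateAt-split x zero    (suc c) = sym (+-identityʳ _)
  updateAt-split x (suc t) zero    = sym (+-identityʳ _)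
  updateAt-split x (suc t) (suc c) = updateAt-split (tail x) t c

  det-addCol₀Multiples : ∀ n (M : Matrix (suc n)) (x : Fin n → Carrier) → det (suc n) (addCol₀Multiples M x) ≈ det (suc n) M
  det-addCol₀Multiples zero    M x = det-cong 1 {addCol₀Multiples M x} {M} λ { i zero → refl }
  det-addCol₀Multiples (suc n) M x =
    vanishing-from (suc n) ℕₚ.≤-refl x λ c n<c → ⊥-elim (ℕₚ.<⇒≱ (Finₚ.toℕ<n c) n<c)
    where
    vanishing-from : ∀ k → k ≤ suc n → ∀ x → (∀ c → k ≤ toℕ c → x c ≈ 0#) →
                     det (suc (suc n)) (addCol₀Multiples M x) ≈ det (suc (suc n)) M
    vanishing-from zero    _   x x≈0 = det-cong (suc (suc n)) {addCol₀Multiples M x} {M} λ where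
      i zero    → refl
      i (suc c) → trans (+-congˡ (trans (*-congʳ (x≈0 c ℕ.z≤n)) (zeroˡ _))) (+-identityʳ _)
    vanishing-from (suc k) k<n x x≈0 = begin
        det (suc (suc n)) (addCol₀Multiples M x)
      ≈⟨ det-cong (suc (suc n)) split ⟩
        det (suc (suc n)) (addCol₀Multiples (addCol₀Multiples M x′) x″)
      ≈⟨ det-addCol₀Multiple-at n (addCol₀Multiples M x′) x″ t
           (λ b → reflexive (Vecₚ.updateAt-minimal _ t _ (Finₚ.punchInᵢ≢i t b))) ⟩
        det (suc (suc n)) (addCol₀Multiples M x′)
      ≈⟨ vanishing-from k (ℕₚ.<⇒≤ k<n) x′ x′≈0 ⟩
        det (suc (suc n)) M ∎
      where
      t : Fin (suc n)
      t = Fin.fromℕ< k<n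
      x′ x″ : Fin (suc n) → Carrier
      x′ = updateAt x t (λ _ → 0#)
      x″ = updateAt (λ _ → 0#) t (λ _ → x t)
      split : ∀ i j → addCol₀Multiples M x i j ≈ addCol₀Multiples (addCol₀Multiples M x′) x″ i j
      split i zero    = refl
      split i (suc c) = trans (+-congˡ (trans (*-congʳ (updateAt-split x t c)) (distribʳ _ _ _))) (sym (+-assoc _ _ _))
      x′≈0 : ∀ c → k ≤ toℕ c → x′ c ≈ 0#
      x′≈0 c k≤c with c Fin.≟ t
      ... | yes ≡.refl = reflexive (Vecₚ.updateAt-updates t x)
      ... | no c≢t = trans (reflexive (Vecₚ.updateAt-minimal c t x c≢t)) (x≈0 c (ℕₚ.≤∧≢⇒< k≤c k≢c))
        where
        k≢c : k ≡.≢ toℕ c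
        k≢c k≡c = c≢t (Finₚ.toℕ-injective (≡.trans (≡.sym k≡c) (≡.sym (Finₚ.toℕ-fromℕ< k<n))))

  border : ∀ {n} → Carrier → (Fin n → Carrier) → (Fin n → Carrier) → Matrix n → Matrix (suc n)
  border d u v A zero    zero    = d
  border d u v A zero    (suc c) = u c
  border d u v A (suc i) zero    = v i
  border d u v A (suc i) (suc c) = A i c

  det-border-schur : ∀ n (u v : Fin n → Carrier) (A : Matrix n) →
                     det (suc n) (border 1# u v A) ≈ det n (λ i c → A i c - v i * u c)
  det-border-schur n u v A = begin
      det (suc n) (border 1# u v A)
    ≈⟨ det-cong (suc n) cleared ⟩
      det (suc n) (addCol₀Multiples (border 1# (λ _ → 0#) v S) u)
    ≈⟨ det-addCol₀Multiples n (border 1# (λ _ → 0#) v S) u ⟩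
      det (suc n) (border 1# (λ _ → 0#) v S)
    ≈⟨ det-firstRow n (border 1# (λ _ → 0#) v S) (λ _ → refl) ⟩
      1# * det n S
    ≈⟨ *-identityˡ _ ⟩
      det n S ∎
    where
    S : Matrix n
    S i c = A i c - v i * u c
    cleared : ∀ i j → border 1# u v A i j ≈ addCol₀Multiples (border 1# (λ _ → 0#) v S) u i j
    cleared zero    zero    = refl
    cleared zero    (suc c) = sym (trans (+-identityˡ _) (*-identityʳ _))
    cleared (suc i) zero    = refl
    cleared (suc i) (suc c) = sym (begin
      (A i c - v i * u c) + u c * v i   ≈⟨ +-assoc _ _ _ ⟩
      A i c + (- (v i * u c) + u c * v i) ≈⟨ +-congˡ (+-congˡ (*-comm _ _)) ⟩
      A i c + (- (v i * u c) + v i * u c) ≈⟨ +-congˡ (-‿inverseˡ _) ⟩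
      A i c + 0#                          ≈⟨ +-identityʳ _ ⟩
      A i c                               ∎)

  det-border-solve : ∀ n d (u v : Fin n → Carrier) (A : Matrix n) (w : Fin n → Carrier) →
                     (∀ i → v i + ∑ (λ c → w c * A i c) ≈ 0#) →
                     det (suc n) (border d u v A) ≈ (d + ∑ λ c → w c * u c) * det n A
  det-border-solve n d u v A w v+Aw≈0 = begin
    det (suc n) (border d u v A)                   ≈⟨ det-addToCol₀ n (border d u v A) w ⟨
    det (suc n) (setCol₀ (border d u v A) col)     ≈⟨ det-firstCol n (setCol₀ (border d u v A) col) v+Aw≈0 ⟩
    (d + ∑ (λ c → w c * u c)) * det n A            ∎
    where
    col : Fin (suc n) → Carrier
    col i = border d u v A i zero + ∑ λ c → w c * border d u v A i (suc c)

  punchIn-fromℕ : ∀ {n} (b : Fin n) → punchIn (Fin.fromℕ n) b ≡.≡ Fin.inject₁ b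
  punchIn-fromℕ zero    = ≡.refl
  punchIn-fromℕ (suc b) = ≡.cong suc (punchIn-fromℕ b)

  reversalSign : ℕ → Carrier
  reversalSign zero    = 1#
  reversalSign (suc n) = reversalSign n * sgn n

  reversalSign-cancel : ∀ n x → reversalSign n * (reversalSign n * x) ≈ x
  reversalSign-cancel zero    x = trans (*-identityˡ _) (*-identityˡ x)
  reversalSign-cancel (suc n) x = begin
      (r * sgn n) * ((r * sgn n) * x)
    ≈⟨ solve 3 (λ r s x → (r :* s) :* ((r :* s) :* x) := r :* (r :* (s :* (s :* x)))) refl r (sgn n) x ⟩
      r * (r * (sgn n * (sgn n * x)))
    ≈⟨ *-congˡ (*-congˡ (sgn-cancel n x)) ⟩
      r * (r * x)
    ≈⟨ reversalSign-cancel n x ⟩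
      x ∎
    where r = reversalSign n

  det-reverseCols : ∀ n (M : Matrix n) → det n (λ i j → M i (opposite j)) ≈ reversalSign n * det n M
  det-reverseCols zero    M = sym (*-identityˡ 1#)
  det-reverseCols (suc n) M = begin
      det (suc n) (λ i j → M i (opposite j))
    ≈⟨ det-expandCol₀ n (λ i j → M i (opposite j)) ⟩
      ∑ (λ i → (sgn (toℕ i) * K i zero) * det n (λ a b → M (punchIn i a) (Fin.inject₁ (opposite b))))
    ≈⟨ ∑-cong (λ i → *-congˡ (det-cong n λ a b →
         reflexive (≡.cong (M (punchIn i a)) (≡.sym (punchIn-fromℕ (opposite b)))))) ⟩
      ∑ (λ i → (sgn (toℕ i) * K i zero) * det n (λ a b → colMinor i K a (opposite b)))
    ≈⟨ ∑-cong (λ i → *-congˡ (det-reverseCols n (colMinor i K))) ⟩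
      ∑ (λ i → (sgn (toℕ i) * K i zero) * (reversalSign n * det n (colMinor i K)))
    ≈⟨ ∑-cong (λ i → solve 3 (λ x r d → x :* (r :* d) := r :* (x :* d)) refl _ _ _) ⟩
      ∑ (λ i → reversalSign n * ((sgn (toℕ i) * K i zero) * det n (colMinor i K)))
    ≈⟨ *-distribˡ-∑ _ _ ⟨
      reversalSign n * ∑ (λ i → (sgn (toℕ i) * K i zero) * det n (colMinor i K))
    ≈⟨ *-congˡ (det-expandCol₀ n K) ⟨
      reversalSign n * det (suc n) K
    ≈⟨ *-congˡ (det-toFront n (Fin.fromℕ n) M) ⟩
      reversalSign n * (sgn (toℕ (Fin.fromℕ n)) * det (suc n) M)
    ≈⟨ *-congˡ (*-congʳ (reflexive (≡.cong sgn (Finₚ.toℕ-fromℕ n)))) ⟩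
      reversalSign n * (sgn n * det (suc n) M)
    ≈⟨ *-assoc _ _ _ ⟨
      reversalSign (suc n) * det (suc n) M ∎
    where
    K : Matrix (suc n)
    K i j = M i (toFront (Fin.fromℕ n) j)

  det-reverseRows : ∀ n (M : Matrix n) → det n (λ i j → M (opposite i) j) ≈ reversalSign n * det n M
  det-reverseRows n M = begin
    det n (λ i j → M (opposite i) j)        ≈⟨ det-ᵀ n (λ i j → M (opposite i) j) ⟨
    det n (λ i j → (M ᵀ) i (opposite j))    ≈⟨ det-reverseCols n (M ᵀ) ⟩
    reversalSign n * det n (M ᵀ)            ≈⟨ *-congˡ (det-ᵀ n M) ⟩
    reversalSign n * det n M                ∎

  det-reverse : ∀ n (M : Matrix n) → det n (λ i j → M (opposite i) (opposite j)) ≈ det n M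
  det-reverse n M = begin
    det n (λ i j → M (opposite i) (opposite j))           ≈⟨ det-reverseRows n (λ i j → M i (opposite j)) ⟩
    reversalSign n * det n (λ i j → M i (opposite j))     ≈⟨ *-congˡ (det-reverseCols n M) ⟩
    reversalSign n * (reversalSign n * det n M)           ≈⟨ reversalSign-cancel n _ ⟩
    det n M                                               ∎

module DeterminantHomomorphism
  {a₁ ℓ₁ a₂ ℓ₂} (R : CommutativeRing a₁ ℓ₁) (S : CommutativeRing a₂ ℓ₂)
  {f : CommutativeRing.Carrier R → CommutativeRing.Carrier S}
  (f-isRingHomomorphism : IsRingHomomorphism (CommutativeRing.rawRing R) (CommutativeRing.rawRing S) f)
  where

  private
    module R = CommutativeRing R
    module DR = Determinant R
    module DS = Determinant S
  open CommutativeRing S hiding (zero)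
  open IsRingHomomorphism f-isRingHomomorphism
  open import Relation.Binary.Reasoning.Setoid setoid

  ∑-homo : ∀ n (g : Fin n → R.Carrier) → f (DR.∑ g) ≈ DS.∑ (f ∘ g)
  ∑-homo zero    g = trans (⟦⟧-cong (DR.∑-zero {f = g} λ ())) (trans 0#-homo (sym (DS.∑-zero λ ())))
  ∑-homo (suc n) g = begin
    f (DR.∑ g)                         ≈⟨ ⟦⟧-cong (DR.∑-suc g) ⟩
    f (g zero R.+ DR.∑ (g ∘ suc))      ≈⟨ +-homo _ _ ⟩
    f (g zero) + f (DR.∑ (g ∘ suc))    ≈⟨ +-congˡ (∑-homo n (g ∘ suc)) ⟩
    f (g zero) + DS.∑ (f ∘ g ∘ suc)    ≈⟨ DS.∑-suc (f ∘ g) ⟨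
    DS.∑ (f ∘ g)                       ∎

  sgn-homo : ∀ k → f (DR.sgn k) ≈ DS.sgn k
  sgn-homo zero    = 1#-homo
  sgn-homo (suc k) = trans (-‿homo _) (-‿cong (sgn-homo k))

  det-homo : ∀ n (M : DR.Matrix n) → f (DR.det n M) ≈ DS.det n (λ i j → f (M i j))
  det-homo zero    M = 1#-homo
  det-homo (suc n) M = trans (∑-homo (suc n) _) (DS.∑-cong λ j → begin
      f ((DR.sgn (toℕ j) R.* M zero j) R.* DR.det n (DR.minor j M))
    ≈⟨ *-homo _ _ ⟩
      f (DR.sgn (toℕ j) R.* M zero j) * f (DR.det n (DR.minor j M))
    ≈⟨ *-cong (trans (*-homo _ _) (*-congʳ (sgn-homo (toℕ j)))) (det-homo n (DR.minor j M)) ⟩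
      (DS.sgn (toℕ j) * f (M zero j)) * DS.det n (DS.minor j λ a b → f (M a b)) ∎)

module PowerSeries where

  open ≡
  open import Data.Integer using (-_)

  sumUpTo-cong : ∀ n {f g : ℕ → ℤ} → (∀ {k} → k ≤ n → f k ≡ g k) → sumUpTo n f ≡ sumUpTo n g
  sumUpTo-cong zero    f≡g = f≡g z≤n
  sumUpTo-cong (suc n) f≡g = cong₂ ℤ._+_ (sumUpTo-cong n (f≡g ∘ ℕₚ.m≤n⇒m≤1+n)) (f≡g ℕₚ.≤-refl)

  sumUpTo-+ : ∀ n (f g : ℕ → ℤ) → sumUpTo n (λ k → f k ℤ.+ g k) ≡ sumUpTo n f ℤ.+ sumUpTo n g
  sumUpTo-+ zero    f g = refl
  sumUpTo-+ (suc n) f g = trans (cong (ℤ._+ (f (suc n) ℤ.+ g (suc n))) (sumUpTo-+ n f g))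
    (interchange (sumUpTo n f) (sumUpTo n g) (f (suc n)) (g (suc n)))
    where
    interchange : ∀ a b c d → (a ℤ.+ b) ℤ.+ (c ℤ.+ d) ≡ (a ℤ.+ c) ℤ.+ (b ℤ.+ d)
    interchange = ℤ-Solver.solve-∀

  sumUpTo-*ˡ : ∀ n a (f : ℕ → ℤ) → sumUpTo n (λ k → a ℤ.* f k) ≡ a ℤ.* sumUpTo n f
  sumUpTo-*ˡ zero    a f = refl
  sumUpTo-*ˡ (suc n) a f = trans (cong (ℤ._+ (a ℤ.* f (suc n))) (sumUpTo-*ˡ n a f)) (sym (ℤₚ.*-distribˡ-+ a _ _))

  sumUpTo-zero : ∀ n → sumUpTo n (λ _ → + 0) ≡ + 0
  sumUpTo-zero zero    = refl
  sumUpTo-zero (suc n) = cong (ℤ._+ + 0) (sumUpTo-zero n)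

  sumUpTo-suc : ∀ n (f : ℕ → ℤ) → sumUpTo (suc n) f ≡ f 0 ℤ.+ sumUpTo n (f ∘ suc)
  sumUpTo-suc zero    f = refl
  sumUpTo-suc (suc n) f = trans (cong (ℤ._+ f (suc (suc n))) (sumUpTo-suc n f)) (ℤₚ.+-assoc (f 0) _ _)

  sumUpTo-reverse : ∀ n (f : ℕ → ℤ) → sumUpTo n f ≡ sumUpTo n (λ k → f (n ∸ k))
  sumUpTo-reverse zero    f = refl
  sumUpTo-reverse (suc n) f = begin
    sumUpTo n f ℤ.+ f (suc n)                     ≡⟨ cong (ℤ._+ f (suc n)) (sumUpTo-reverse n f) ⟩
    sumUpTo n (λ k → f (n ∸ k)) ℤ.+ f (suc n)     ≡⟨ ℤₚ.+-comm _ (f (suc n)) ⟩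
    f (suc n) ℤ.+ sumUpTo n (λ k → f (n ∸ k))     ≡⟨ sumUpTo-suc n (λ k → f (suc n ∸ k)) ⟨
    sumUpTo (suc n) (λ k → f (suc n ∸ k))         ∎
    where open ≡-Reasoning

  0S : Series
  0S _ = + 0

  ⊛-cong : ∀ {f f′ g g′} → f ≗ f′ → g ≗ g′ → f ⊛ g ≗ f′ ⊛ g′
  ⊛-cong f≗f′ g≗g′ n = sumUpTo-cong n λ {k} _ → cong₂ ℤ._*_ (f≗f′ k) (g≗g′ (n ∸ k))

  ⊛-comm : ∀ f g → f ⊛ g ≗ g ⊛ f
  ⊛-comm f g n = trans (sumUpTo-reverse n _) (sumUpTo-cong n λ {k} k≤n →
    trans (cong (λ j → f (n ∸ k) ℤ.* g j) (ℕₚ.m∸[m∸n]≡n k≤n)) (ℤₚ.*-comm (f (n ∸ k)) (g k)))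

  ⊛-suc : ∀ f g n → (f ⊛ g) (suc n) ≡ f 0 ℤ.* g (suc n) ℤ.+ ((f ∘ suc) ⊛ g) n
  ⊛-suc f g n = sumUpTo-suc n (λ k → f k ℤ.* g (suc n ∸ k))

  ⊛-distribʳ : ∀ f g h → (f ⊕ g) ⊛ h ≗ (f ⊛ h) ⊕ (g ⊛ h)
  ⊛-distribʳ f g h n = trans (sumUpTo-cong n λ {k} _ → ℤₚ.*-distribʳ-+ (h (n ∸ k)) (f k) (g k)) (sumUpTo-+ n _ _)

  ⊛-distribˡ : ∀ f g h → f ⊛ (g ⊕ h) ≗ (f ⊛ g) ⊕ (f ⊛ h)
  ⊛-distribˡ f g h n = trans (⊛-comm f (g ⊕ h) n)
    (trans (⊛-distribʳ g h f n) (cong₂ ℤ._+_ (⊛-comm g f n) (⊛-comm h f n)))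

  ⊛-scaleˡ : ∀ a f g n → ((λ k → a ℤ.* f k) ⊛ g) n ≡ a ℤ.* (f ⊛ g) n
  ⊛-scaleˡ a f g n = trans (sumUpTo-cong n λ _ → ℤₚ.*-assoc a _ _) (sumUpTo-*ˡ n a _)

  ⊛-assoc : ∀ f g h → (f ⊛ g) ⊛ h ≗ f ⊛ (g ⊛ h)
  ⊛-assoc f g h zero    = ℤₚ.*-assoc (f 0) (g 0) (h 0)
  ⊛-assoc f g h (suc n) = begin
      ((f ⊛ g) ⊛ h) (suc n)
    ≡⟨ ⊛-suc (f ⊛ g) h n ⟩
      (f 0 ℤ.* g 0) ℤ.* h (suc n) ℤ.+ (((f ⊛ g) ∘ suc) ⊛ h) n
    ≡⟨ cong (λ z → (f 0 ℤ.* g 0) ℤ.* h (suc n) ℤ.+ z)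
         (⊛-cong {f = (f ⊛ g) ∘ suc} {g = h} (⊛-suc f g) (λ _ → refl) n) ⟩
      (f 0 ℤ.* g 0) ℤ.* h (suc n) ℤ.+ (((λ k → f 0 ℤ.* g (suc k)) ⊕ ((f ∘ suc) ⊛ g)) ⊛ h) n
    ≡⟨ cong (λ z → (f 0 ℤ.* g 0) ℤ.* h (suc n) ℤ.+ z)
         (trans (⊛-distribʳ (λ k → f 0 ℤ.* g (suc k)) ((f ∘ suc) ⊛ g) h n)
         (cong₂ ℤ._+_ (⊛-scaleˡ (f 0) (g ∘ suc) h n) (⊛-assoc (f ∘ suc) g h n))) ⟩
      (f 0 ℤ.* g 0) ℤ.* h (suc n) ℤ.+ (f 0 ℤ.* ((g ∘ suc) ⊛ h) n ℤ.+ ((f ∘ suc) ⊛ (g ⊛ h)) n)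
    ≡⟨ regroup (f 0) (g 0) (h (suc n)) (((g ∘ suc) ⊛ h) n) (((f ∘ suc) ⊛ (g ⊛ h)) n) ⟩
      f 0 ℤ.* (g 0 ℤ.* h (suc n) ℤ.+ ((g ∘ suc) ⊛ h) n) ℤ.+ ((f ∘ suc) ⊛ (g ⊛ h)) n
    ≡⟨ cong (λ z → f 0 ℤ.* z ℤ.+ ((f ∘ suc) ⊛ (g ⊛ h)) n) (⊛-suc g h n) ⟨
      f 0 ℤ.* (g ⊛ h) (suc n) ℤ.+ ((f ∘ suc) ⊛ (g ⊛ h)) n
    ≡⟨ ⊛-suc f (g ⊛ h) n ⟨
      (f ⊛ (g ⊛ h)) (suc n) ∎
    where
    open ≡-Reasoning
    regroup : ∀ a b c d e → (a ℤ.* b) ℤ.* c ℤ.+ (a ℤ.* d ℤ.+ e) ≡ a ℤ.* (b ℤ.* c ℤ.+ d) ℤ.+ e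
    regroup = ℤ-Solver.solve-∀

  ⊛-identityˡ : ∀ f → oneS ⊛ f ≗ f
  ⊛-identityˡ f zero    = ℤₚ.*-identityˡ (f 0)
  ⊛-identityˡ f (suc n) = begin
    (oneS ⊛ f) (suc n)                            ≡⟨ ⊛-suc oneS f n ⟩
    + 1 ℤ.* f (suc n) ℤ.+ sumUpTo n (λ _ → + 0)   ≡⟨ cong₂ ℤ._+_ (ℤₚ.*-identityˡ (f (suc n))) (sumUpTo-zero n) ⟩
    f (suc n) ℤ.+ + 0                             ≡⟨ ℤₚ.+-identityʳ _ ⟩
    f (suc n)                                     ∎
    where open ≡-Reasoning

  ⊕-⊛-isCommutativeRing : IsCommutativeRing _≗_ _⊕_ _⊛_ negS 0S oneS
  ⊕-⊛-isCommutativeRing = record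
    { isRing = record
      { +-isAbelianGroup = record
        { isGroup = record
          { isMonoid = record
            { isSemigroup = record
              { isMagma = record
                { isEquivalence = record { refl = λ _ → refl ; sym = λ p n → sym (p n) ; trans = λ p q n → trans (p n) (q n) }
                ; ∙-cong = λ p q n → cong₂ ℤ._+_ (p n) (q n)
                }
              ; assoc = λ f g h n → ℤₚ.+-assoc (f n) (g n) (h n)
              }
            ; identity = (λ f n → ℤₚ.+-identityˡ (f n)) , (λ f n → ℤₚ.+-identityʳ (f n))
            }
          ; inverse = (λ f n → ℤₚ.+-inverseˡ (f n)) , (λ f n → ℤₚ.+-inverseʳ (f n))
          ; ⁻¹-cong = λ p n → cong -_ (p n)
          }
        ; comm = λ f g n → ℤₚ.+-comm (f n) (g n)
        }
      ; *-cong = ⊛-cong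
      ; *-assoc = ⊛-assoc
      ; *-identity = ⊛-identityˡ , (λ f n → trans (⊛-comm f oneS n) (⊛-identityˡ f n))
      ; distrib = ⊛-distribˡ , (λ h f g → ⊛-distribʳ f g h)
      }
    ; *-comm = ⊛-comm
    }

  ℤ[[x]] : CommutativeRing 0ℓ 0ℓ
  ℤ[[x]] = record { isCommutativeRing = ⊕-⊛-isCommutativeRing }

  constS-⊛ : ∀ a f n → (constS a ⊛ f) n ≡ a ℤ.* f n
  constS-⊛ a f zero    = refl
  constS-⊛ a f (suc n) = trans (⊛-suc (constS a) f n)
    (trans (cong (λ z → a ℤ.* f (suc n) ℤ.+ z) (sumUpTo-zero n)) (ℤₚ.+-identityʳ _))

  X-⊛ : ∀ f n → (X ⊛ f) (suc n) ≡ f n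
  X-⊛ f n = trans (⊛-suc X f n) (trans (ℤₚ.+-identityˡ _)
    (trans (⊛-cong {f = X ∘ suc} {f′ = oneS} {g = f} (λ { zero → refl ; (suc _) → refl }) (λ _ → refl) n)
           (⊛-identityˡ f n)))

  x↦-x : Series → Series
  x↦-x f n = sign n ℤ.* f n

  sign-+ : ∀ j k → sign (j ℕ.+ k) ≡ sign j ℤ.* sign k
  sign-+ zero    k = sym (ℤₚ.*-identityˡ (sign k))
  sign-+ (suc j) k = trans (cong -_ (sign-+ j k)) (ℤₚ.neg-distribˡ-* (sign j) (sign k))

  x↦-x-⊛ : ∀ f g → x↦-x (f ⊛ g) ≗ x↦-x f ⊛ x↦-x g
  x↦-x-⊛ f g n = trans (sym (sumUpTo-*ˡ n (sign n) _)) (sumUpTo-cong n λ {k} k≤n →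
    trans (cong (ℤ._* (f k ℤ.* g (n ∸ k))) (trans (cong sign (sym (ℕₚ.m+[n∸m]≡n k≤n))) (sign-+ k (n ∸ k))))
          (interchange (sign k) (sign (n ∸ k)) (f k) (g (n ∸ k))))
    where
    interchange : ∀ s t a b → (s ℤ.* t) ℤ.* (a ℤ.* b) ≡ (s ℤ.* a) ℤ.* (t ℤ.* b)
    interchange = ℤ-Solver.solve-∀

  x↦-x-isRingHomomorphism : IsRingHomomorphism (CommutativeRing.rawRing ℤ[[x]]) (CommutativeRing.rawRing ℤ[[x]]) x↦-x
  x↦-x-isRingHomomorphism = record
    { isSemiringHomomorphism = record
      { isNearSemiringHomomorphism = record
        { +-isMonoidHomomorphism = record
          { isMagmaHomomorphism = record
            { isRelHomomorphism = record { cong = λ p n → cong (sign n ℤ.*_) (p n) }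
            ; homo = λ f g n → ℤₚ.*-distribˡ-+ (sign n) (f n) (g n)
            }
          ; ε-homo = λ n → ℤₚ.*-zeroʳ (sign n)
          }
        ; *-homo = x↦-x-⊛
        }
      ; 1#-homo = λ { zero → refl ; (suc n) → ℤₚ.*-zeroʳ (sign (suc n)) }
      }
    ; -‿homo = λ f n → sym (ℤₚ.neg-distribʳ-* (sign n) (f n))
    }

open ≡ using (_≡_; _≗_; refl; sym; trans; cong; cong₂; subst; module ≡-Reasoning)
open import Data.Integer using (-_)
open PowerSeries
open Determinant ℤ[[x]]
open DeterminantHomomorphism ℤ[[x]] ℤ[[x]] x↦-x-isRingHomomorphism using (det-homo)
module R = CommutativeRing ℤ[[x]]

sumℕ-cong : ∀ n {f g : Fin n → ℕ} → (∀ i → f i ≡ g i) → sumℕ n f ≡ sumℕ n g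
sumℕ-cong zero    f≡g = refl
sumℕ-cong (suc n) f≡g = cong₂ ℕ._+_ (f≡g zero) (sumℕ-cong n (f≡g ∘ suc))

sumℕ-zero : ∀ n → sumℕ n (λ _ → 0) ≡ 0
sumℕ-zero zero    = refl
sumℕ-zero (suc n) = sumℕ-zero n

sumℕ-+ : ∀ n (f g : Fin n → ℕ) → sumℕ n (λ i → f i ℕ.+ g i) ≡ sumℕ n f ℕ.+ sumℕ n g
sumℕ-+ zero    f g = refl
sumℕ-+ (suc n) f g = trans (cong (f zero ℕ.+ g zero ℕ.+_) (sumℕ-+ n (f ∘ suc) (g ∘ suc)))
  (interchange (f zero) (g zero) (sumℕ n (f ∘ suc)) (sumℕ n (g ∘ suc)))
  where
  interchange : ∀ a b c d → (a ℕ.+ b) ℕ.+ (c ℕ.+ d) ≡ (a ℕ.+ c) ℕ.+ (b ℕ.+ d)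
  interchange = ℕ-Solver.solve-∀

sumℕ-comm : ∀ n k (f : Fin n → Fin k → ℕ) →
            sumℕ n (λ i → sumℕ k (f i)) ≡ sumℕ k (λ j → sumℕ n (λ i → f i j))
sumℕ-comm zero    k f = sym (sumℕ-zero k)
sumℕ-comm (suc n) k f = trans (cong (sumℕ k (f zero) ℕ.+_) (sumℕ-comm n k (f ∘ suc))) (sym (sumℕ-+ k (f zero) _))

sumℕ-*ʳ : ∀ n (f : Fin n → ℕ) x → sumℕ n (λ i → f i ℕ.* x) ≡ sumℕ n f ℕ.* x
sumℕ-*ʳ zero    f x = refl
sumℕ-*ʳ (suc n) f x = trans (cong (f zero ℕ.* x ℕ.+_) (sumℕ-*ʳ n (f ∘ suc) x)) (sym (ℕₚ.*-distribʳ-+ x (f zero) _))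

sumℕ-idMat-col : ∀ n (c : Fin n) → sumℕ n (λ j → idMat n j c) ≡ 1
sumℕ-idMat-col (suc n) zero    = cong suc (sumℕ-zero n)
sumℕ-idMat-col (suc n) (suc c) = sumℕ-idMat-col n c

sumℕ-idMat-row : ∀ n (i : Fin n) (f : Fin n → ℕ) → sumℕ n (λ c → idMat n i c ℕ.* f c) ≡ f i
sumℕ-idMat-row (suc n) zero    f =
  trans (cong (f zero ℕ.+ 0 ℕ.+_) (sumℕ-zero n)) (trans (ℕₚ.+-identityʳ _) (ℕₚ.+-identityʳ _))
sumℕ-idMat-row (suc n) (suc i) f = sumℕ-idMat-row n i (f ∘ suc)

B-sym : ∀ k (i j : Fin k) → B k i j ≡ B k j i
B-sym k i j = cong (λ x → if x <ᵇ k then 1 else 0) (ℕₚ.+-comm (toℕ i) (toℕ j))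

colSum : ∀ {k} → Mat k → Fin k → ℕ
colSum {k} P c = sumℕ k (λ j → P j c)

s≡sumℕ-colSum : ∀ {k} (P : Mat k) → s P ≡ sumℕ k (colSum P)
s≡sumℕ-colSum {k} P = sumℕ-comm k k P

colSum-⊗ : ∀ {k} (P A : Mat k) i → colSum (P ⊗ A) i ≡ sumℕ k (λ c → A c i ℕ.* colSum P c)
colSum-⊗ {k} P A i = trans (sumℕ-comm k k λ j c → P j c ℕ.* A c i) (sumℕ-cong k λ c →
  trans (sumℕ-*ʳ k (λ j → P j c) (A c i)) (ℕₚ.*-comm (colSum P c) (A c i)))

matPow-B₁ : ∀ n → matPow (B 1) n zero zero ≡ 1
matPow-B₁ zero    = refl
matPow-B₁ (suc n) = cong (λ x → x ℕ.* 1 ℕ.+ 0) (matPow-B₁ n)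

b-suc : ∀ m n → b (suc n) m ≡ s (matPow (B (suc m)) n)
b-suc zero    n = sym (cong (λ x → x ℕ.+ 0 ℕ.+ 0) (matPow-B₁ n))
b-suc (suc m) n = refl


ι : ℕ → Series
ι k = constS (+ k)

IminusXB IplusXB : ∀ k → Fin k → Fin k → Series
IminusXB k i j = ι (idMat k i j) ⊕ negS (ι (B k i j) ⊛ X)
IplusXB  k i j = ι (idMat k i j) ⊕ (ι (B k i j) ⊛ X)

-- W k c = Σₙ (column sum c of B(k)ⁿ) xⁿ, the c-th entry of 1ᵀ(I - xB(k))⁻¹.
W : ∀ k → Fin k → Series
W k c n = + colSum (matPow (B k) n) c

∑-pos : ∀ k (g : Fin k → ℕ → ℕ) → ∑ (λ c n → + g c n) ≗ λ n → + sumℕ k (λ c → g c n)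
∑-pos zero    g n = ∑-zero {f = λ c n → + g c n} (λ ()) n
∑-pos (suc k) g n = trans (∑-suc (λ c n → + g c n) n) (cong (λ z → + g zero n ℤ.+ z) (∑-pos k (g ∘ suc) n))

∑ι⊛W : ∀ k (a : Fin k → ℕ) →
       ∑ (λ c → ι (a c) ⊛ W k c) ≗ λ n → + sumℕ k (λ c → a c ℕ.* colSum (matPow (B k) n) c)
∑ι⊛W k a n = trans
  (∑-cong {f = λ c → ι (a c) ⊛ W k c} {g = λ c n → + (a c ℕ.* colSum (matPow (B k) n) c)}
    (λ c n → trans (constS-⊛ (+ a c) (W k c) n) (sym (ℤₚ.pos-* (a c) _))) n)
  (∑-pos k (λ c n → a c ℕ.* colSum (matPow (B k) n) c) n)

W-δ : ∀ k i → ∑ (λ c → ι (idMat k i c) ⊛ W k c) ≗ W k i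
W-δ k i n = trans (∑ι⊛W k (idMat k i) n) (cong +_ (sumℕ-idMat-row k i _))

W-rec : ∀ k i → W k i ≗ oneS ⊕ (X ⊛ ∑ λ c → ι (B k i c) ⊛ W k c)
W-rec k i zero    = cong +_ (sumℕ-idMat-col k i)
W-rec k i (suc n) = begin
  + colSum (matPow (B k) n ⊗ B k) i                               ≡⟨ cong +_ (colSum-⊗ (matPow (B k) n) (B k) i) ⟩
  + sumℕ k (λ c → B k c i ℕ.* colSum (matPow (B k) n) c)          ≡⟨ cong +_ (sumℕ-cong k λ c → cong (ℕ._* _) (B-sym k c i)) ⟩
  + sumℕ k (λ c → B k i c ℕ.* colSum (matPow (B k) n) c)          ≡⟨ ∑ι⊛W k (B k i) n ⟨
  ∑ (λ c → ι (B k i c) ⊛ W k c) n                                  ≡⟨ X-⊛ (∑ λ c → ι (B k i c) ⊛ W k c) n ⟨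
  (X ⊛ ∑ λ c → ι (B k i c) ⊛ W k c) (suc n)                       ≡⟨ ℤₚ.+-identityˡ _ ⟨
  (oneS ⊕ (X ⊛ ∑ λ c → ι (B k i c) ⊛ W k c)) (suc n)              ∎
  where open ≡-Reasoning

F-expansion : ∀ m → F m ≗ oneS ⊕ (X ⊛ ∑ (W (suc m)))
F-expansion m zero    = refl
F-expansion m (suc n) = begin
  + b (suc n) m                                    ≡⟨ cong +_ (trans (b-suc m n) (s≡sumℕ-colSum (matPow (B (suc m)) n))) ⟩
  + sumℕ (suc m) (colSum (matPow (B (suc m)) n))   ≡⟨ ∑-pos (suc m) (λ c n → colSum (matPow (B (suc m)) n) c) n ⟨
  ∑ (W (suc m)) n                                  ≡⟨ X-⊛ (∑ (W (suc m))) n ⟨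
  (X ⊛ ∑ (W (suc m))) (suc n)                      ≡⟨ ℤₚ.+-identityˡ _ ⟨
  (oneS ⊕ (X ⊛ ∑ (W (suc m)))) (suc n)             ∎
  where open ≡-Reasoning

F-bordered : ∀ m → F m ≗ oneS ⊕ ∑ (λ c → (X ⊛ W (suc m) c) ⊛ oneS)
F-bordered m = R.trans (F-expansion m) (R.+-congˡ {oneS} (R.trans (*-distribˡ-∑ X (W (suc m)))
  (∑-cong λ c → R.sym (R.*-identityʳ (X ⊛ W (suc m) c)))))

W-left-inverse : ∀ k i → ∑ (λ c → W k c ⊛ IminusXB k i c) ≗ oneS
W-left-inverse k i = begin
    ∑ (λ c → W k c ⊛ IminusXB k i c)
  ≈⟨ ∑-cong expand ⟩
    ∑ (λ c → (ι (idMat k i c) ⊛ W k c) ⊕ negS (X ⊛ (ι (B k i c) ⊛ W k c)))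
  ≈⟨ ∑-distrib-+ (λ c → ι (idMat k i c) ⊛ W k c) (λ c → negS (X ⊛ (ι (B k i c) ⊛ W k c))) ⟩
    ∑ (λ c → ι (idMat k i c) ⊛ W k c) ⊕ ∑ (λ c → negS (X ⊛ (ι (B k i c) ⊛ W k c)))
  ≈⟨ R.+-cong (W-δ k i) (R.trans (∑-neg λ c → X ⊛ (ι (B k i c) ⊛ W k c))
                                  (R.-‿cong (R.sym (*-distribˡ-∑ X λ c → ι (B k i c) ⊛ W k c)))) ⟩
    W k i ⊕ negS (X ⊛ BW)
  ≈⟨ R.+-congʳ {negS (X ⊛ BW)} (W-rec k i) ⟩
    (oneS ⊕ (X ⊛ BW)) ⊕ negS (X ⊛ BW)
  ≈⟨ R.+-assoc oneS (X ⊛ BW) (negS (X ⊛ BW)) ⟩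
    oneS ⊕ ((X ⊛ BW) ⊕ negS (X ⊛ BW))
  ≈⟨ R.+-congˡ {oneS} (R.-‿inverseʳ (X ⊛ BW)) ⟩
    oneS ⊕ 0S
  ≈⟨ R.+-identityʳ oneS ⟩
    oneS ∎
  where
  open import Relation.Binary.Reasoning.Setoid R.setoid
  open import Algebra.Properties.Ring R.ring using (-‿distribʳ-*)
  open import Algebra.Solver.Ring.NaturalCoefficients.Default R.commutativeSemiring using (solve; _:=_; _:*_)
  BW : Series
  BW = ∑ λ c → ι (B k i c) ⊛ W k c
  expand : ∀ c → W k c ⊛ IminusXB k i c ≗ (ι (idMat k i c) ⊛ W k c) ⊕ negS (X ⊛ (ι (B k i c) ⊛ W k c))
  expand c = R.trans (R.distribˡ (W k c) (ι (idMat k i c)) (negS (ι (B k i c) ⊛ X))) (R.+-cong (R.*-comm (W k c) (ι (idMat k i c)))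
    (R.trans (R.sym (-‿distribʳ-* (W k c) (ι (B k i c) ⊛ X))) (R.-‿cong
      (solve 3 (λ w β x → w :* (β :* x) := x :* (β :* w)) R.refl (W k c) (ι (B k i c)) X))))

W-solves : ∀ k i → negS X ⊕ ∑ (λ c → (X ⊛ W k c) ⊛ IminusXB k i c) ≗ 0S
W-solves k i = begin
    negS X ⊕ ∑ (λ c → (X ⊛ W k c) ⊛ IminusXB k i c)
  ≈⟨ R.+-congˡ {negS X} (∑-cong λ c → R.*-assoc X (W k c) (IminusXB k i c)) ⟩
    negS X ⊕ ∑ (λ c → X ⊛ (W k c ⊛ IminusXB k i c))
  ≈⟨ R.+-congˡ {negS X} (*-distribˡ-∑ X λ c → W k c ⊛ IminusXB k i c) ⟨
    negS X ⊕ (X ⊛ ∑ λ c → W k c ⊛ IminusXB k i c)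
  ≈⟨ R.+-congˡ {negS X} (R.*-congˡ {X} (W-left-inverse k i)) ⟩
    negS X ⊕ (X ⊛ oneS)
  ≈⟨ R.+-congˡ {negS X} (R.*-identityʳ X) ⟩
    negS X ⊕ X
  ≈⟨ R.-‿inverseˡ X ⟩
    0S ∎
  where open import Relation.Binary.Reasoning.Setoid R.setoid

sumS≗∑ : ∀ n (f : Fin n → Series) → sumS n f ≗ ∑ f
sumS≗∑ zero    f zero    = sym (∑-zero {f = f} (λ ()) zero)
sumS≗∑ zero    f (suc k) = sym (∑-zero {f = f} (λ ()) (suc k))
sumS≗∑ (suc n) f k = trans (cong (λ z → f zero k ℤ.+ z) (sumS≗∑ n (f ∘ suc) k)) (sym (∑-suc f k))

sign≗sgn : ∀ k → constS (sign k) ≗ sgn k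
sign≗sgn zero    n       = refl
sign≗sgn (suc k) zero    = cong -_ (sign≗sgn k zero)
sign≗sgn (suc k) (suc n) = cong -_ (sign≗sgn k (suc n))

Defs-det≗det : ∀ n (M : Fin n → Fin n → Series) → Defs.det n M ≗ det n M
Defs-det≗det zero    M = λ _ → refl
Defs-det≗det (suc n) M = R.trans (sumS≗∑ (suc n) _) (∑-cong λ j →
  R.*-cong (R.*-congʳ {M zero j} (sign≗sgn (toℕ j))) (Defs-det≗det n (minor j M)))

Q≗det : ∀ m → Q m ≗ det m (IminusXB m)
Q≗det zero    = λ _ → refl
Q≗det (suc m) = Defs-det≗det (suc m) (IminusXB (suc m))

x↦-x-IminusXB : ∀ k i j → x↦-x (IminusXB k i j) ≗ IplusXB k i j
x↦-x-IminusXB k i j n = trans (cong (λ z → sign n ℤ.* (ι (idMat k i j) n ℤ.+ - z)) (constS-⊛ (+ B k i j) X n))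
  (trans (flip-coeff n (+ idMat k i j) (+ B k i j)) (cong (λ z → ι (idMat k i j) n ℤ.+ z) (sym (constS-⊛ (+ B k i j) X n))))
  where
  coeff₀ : ∀ d β → + 1 ℤ.* (d ℤ.+ - (β ℤ.* + 0)) ≡ d ℤ.+ β ℤ.* + 0
  coeff₀ = ℤ-Solver.solve-∀
  coeff₁ : ∀ β → - + 1 ℤ.* (+ 0 ℤ.+ - (β ℤ.* + 1)) ≡ + 0 ℤ.+ β ℤ.* + 1
  coeff₁ = ℤ-Solver.solve-∀
  coeff₂₊ : ∀ s β → s ℤ.* (+ 0 ℤ.+ - (β ℤ.* + 0)) ≡ + 0 ℤ.+ β ℤ.* + 0
  coeff₂₊ = ℤ-Solver.solve-∀
  flip-coeff : ∀ n d β → sign n ℤ.* (constS d n ℤ.+ - (β ℤ.* X n)) ≡ constS d n ℤ.+ β ℤ.* X n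
  flip-coeff zero          d β = coeff₀ d β
  flip-coeff (suc zero)    d β = coeff₁ β
  flip-coeff (suc (suc n)) d β = coeff₂₊ (sign (suc (suc n))) β

Qneg≗det : ∀ m → Qneg m ≗ det m (IplusXB m)
Qneg≗det m n = trans (cong (sign n ℤ.*_) (Q≗det m n))
  (R.trans (det-homo m (IminusXB m)) (det-cong m (x↦-x-IminusXB m)) n)

<ᵇ-complement : ∀ {s t m} → suc (s ℕ.+ t) ≡ m ℕ.+ m → (s <ᵇ m) ≡ not (t <ᵇ m)
<ᵇ-complement {s} {t} {m} 1+s+t≡2m = Reflects.det
  (Reflects.fromEquivalence (s<m⇒t≮m ∘ ℕₚ.<ᵇ⇒< s m) (ℕₚ.<⇒<ᵇ ∘ t≮m⇒s<m))
  (Reflects.¬-reflects (ℕₚ.<ᵇ-reflects-< t m))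
  where
  s<m⇒t≮m : s ℕ.< m → ¬ t ℕ.< m
  s<m⇒t≮m s<m t<m = ℕₚ.n≮n (m ℕ.+ m)
    (subst (ℕ._≤ m ℕ.+ m) (cong suc (trans (ℕₚ.+-suc s t) 1+s+t≡2m)) (ℕₚ.+-mono-≤ s<m t<m))
  t≮m⇒s<m : ¬ t ℕ.< m → s ℕ.< m
  t≮m⇒s<m t≮m = ℕₚ.+-cancelʳ-< m s m (ℕₚ.≤-<-trans (ℕₚ.+-monoʳ-≤ s (ℕₚ.≮⇒≥ t≮m))
    (subst (s ℕ.+ t ℕ.<_) 1+s+t≡2m (ℕₚ.n<1+n (s ℕ.+ t))))

opposite+suc : ∀ {m} (a : Fin m) → toℕ (opposite a) ℕ.+ suc (toℕ a) ≡ m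
opposite+suc a = trans (cong (ℕ._+ suc (toℕ a)) (Finₚ.opposite-prop a)) (ℕₚ.m∸n+n≡m (Finₚ.toℕ<n a))

B-complement : ∀ m (a b : Fin m) → + 1 ℤ.- + B (suc m) (suc a) (suc b) ≡ + B m (opposite a) (opposite b)
B-complement m a b = trans
  (cong (λ β → + 1 ℤ.- + (if β then 1 else 0))
        (<ᵇ-complement {toℕ a ℕ.+ suc (toℕ b)} {toℕ (opposite a) ℕ.+ toℕ (opposite b)} {m} sum≡2m))
  (one-minus-not (toℕ (opposite a) ℕ.+ toℕ (opposite b) <ᵇ m))
  where
  rearrange : ∀ x y p q → suc ((x ℕ.+ suc y) ℕ.+ (p ℕ.+ q)) ≡ (p ℕ.+ suc x) ℕ.+ (q ℕ.+ suc y)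
  rearrange = ℕ-Solver.solve-∀
  sum≡2m : suc ((toℕ a ℕ.+ suc (toℕ b)) ℕ.+ (toℕ (opposite a) ℕ.+ toℕ (opposite b))) ≡ m ℕ.+ m
  sum≡2m = trans (rearrange (toℕ a) (toℕ b) (toℕ (opposite a)) (toℕ (opposite b)))
                 (cong₂ ℕ._+_ (opposite+suc a) (opposite+suc b))
  one-minus-not : ∀ β → + 1 ℤ.- + (if not β then 1 else 0) ≡ + (if β then 1 else 0)
  one-minus-not true  = refl
  one-minus-not false = refl

B-firstRow : ∀ m (j : Fin m) → + 1 ℤ.- + B (suc m) zero (suc j) ≡ + 0
B-firstRow m j = cong (λ β → + 1 ℤ.- + (if β then 1 else 0))
  (Reflects.det (ℕₚ.<ᵇ-reflects-< (toℕ j) m) (Reflects.of {b = true} (Finₚ.toℕ<n j)))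

idMat-opposite : ∀ m (a b : Fin m) → idMat m (opposite a) (opposite b) ≡ idMat m a b
idMat-opposite m a b = cong (λ β → if β then 1 else 0) (Reflects.det
  (Reflects.fromEquivalence (opposite-cancel ∘ ℕₚ.≡ᵇ⇒≡ _ _)
                            (ℕₚ.≡⇒≡ᵇ _ _ ∘ cong (toℕ ∘ opposite) ∘ Finₚ.toℕ-injective))
  (Reflects.fromEquivalence (ℕₚ.≡ᵇ⇒≡ (toℕ a) (toℕ b)) (ℕₚ.≡⇒≡ᵇ _ _)))
  where
  opposite-cancel : toℕ (opposite a) ≡ toℕ (opposite b) → toℕ a ≡ toℕ b
  opposite-cancel e = cong toℕ (trans (sym (Finₚ.opposite-involutive a))
    (trans (cong opposite (Finₚ.toℕ-injective e)) (Finₚ.opposite-involutive b)))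

schur-entry : ∀ δ β β′ → + 1 ℤ.- + β ≡ + β′ →
              (ι δ ⊕ negS (ι β ⊛ X)) ⊕ negS (negS X ⊛ oneS) ≗ ι δ ⊕ (ι β′ ⊛ X)
schur-entry δ β β′ 1-β≡β′ n = begin
  (ι δ n ℤ.+ - (ι β ⊛ X) n) ℤ.+ - (negS X ⊛ oneS) n
    ≡⟨ cong₂ (λ p q → (ι δ n ℤ.+ - p) ℤ.+ - q) (constS-⊛ (+ β) X n) (R.*-identityʳ (negS X) n) ⟩
  (ι δ n ℤ.+ - (+ β ℤ.* X n)) ℤ.+ - (- X n)     ≡⟨ regroup (ι δ n) (+ β) (X n) ⟩
  ι δ n ℤ.+ (+ 1 ℤ.- + β) ℤ.* X n                ≡⟨ cong (λ z → ι δ n ℤ.+ z ℤ.* X n) 1-β≡β′ ⟩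
  ι δ n ℤ.+ + β′ ℤ.* X n                         ≡⟨ cong (λ z → ι δ n ℤ.+ z) (constS-⊛ (+ β′) X n) ⟨
  ι δ n ℤ.+ (ι β′ ⊛ X) n                         ∎
  where
  open ≡-Reasoning
  regroup : ∀ d b x → (d ℤ.+ - (b ℤ.* x)) ℤ.+ - (- x) ≡ d ℤ.+ (+ 1 ℤ.- b) ℤ.* x
  regroup = ℤ-Solver.solve-∀

-- The Schur complement I - xB + xJ of the corner of [[1, 1ᵀ], [-x1, I - xB]], with B = B(m+1).
Schur : ∀ m → Fin (suc m) → Fin (suc m) → Series
Schur m i c = IminusXB (suc m) i c ⊕ negS (negS X ⊛ oneS)

det-Schur : ∀ m → det (suc m) (Schur m) ≗ det m (IplusXB m)
det-Schur m = begin
  det (suc m) (Schur m)                                        ≈⟨ det-firstRow m (Schur m) row₀ ⟩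
  Schur m zero zero ⊛ det m (minor zero (Schur m))             ≈⟨ R.*-cong corner (det-cong m lower) ⟩
  oneS ⊛ det m (λ a b → IplusXB m (opposite a) (opposite b))   ≈⟨ R.*-identityˡ _ ⟩
  det m (λ a b → IplusXB m (opposite a) (opposite b))          ≈⟨ det-reverse m (IplusXB m) ⟩
  det m (IplusXB m)                                            ∎
  where
  open import Relation.Binary.Reasoning.Setoid R.setoid
  ι⊕ι0⊛X : ∀ δ → ι δ ⊕ (ι 0 ⊛ X) ≗ ι δ
  ι⊕ι0⊛X δ n = trans (cong (λ z → ι δ n ℤ.+ z) (constS-⊛ (+ 0) X n)) (ℤₚ.+-identityʳ (ι δ n))
  ι0≗0 : ι 0 ≗ 0S
  ι0≗0 zero    = refl
  ι0≗0 (suc n) = refl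
  row₀ : ∀ j → Schur m zero (suc j) ≗ 0S
  row₀ j n = trans (schur-entry 0 _ 0 (B-firstRow m j) n) (trans (ι⊕ι0⊛X 0 n) (ι0≗0 n))
  corner : Schur m zero zero ≗ oneS
  corner n = trans (schur-entry 1 1 0 refl n) (ι⊕ι0⊛X 1 n)
  lower : ∀ a b → Schur m (suc a) (suc b) ≗ IplusXB m (opposite a) (opposite b)
  lower a b n = trans (schur-entry (idMat m a b) _ _ (B-complement m a b) n)
    (cong (λ d → ι d n ℤ.+ (ι (B m (opposite a) (opposite b)) ⊛ X) n) (sym (idMat-opposite m a b)))

theorem5 : (m n : ℕ) → (F m ⊛ Q (suc m)) n ≡ Qneg m n
theorem5 m = begin
    F m ⊛ Q N
  ≈⟨ R.*-cong (F-bordered m) (Q≗det N) ⟩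
    (oneS ⊕ ∑ (λ c → (X ⊛ W N c) ⊛ oneS)) ⊛ det N A
  ≈⟨ det-border-solve N oneS (λ _ → oneS) (λ _ → negS X) A (λ c → X ⊛ W N c) (W-solves N) ⟨
    det (suc N) (border oneS (λ _ → oneS) (λ _ → negS X) A)
  ≈⟨ det-border-schur N (λ _ → oneS) (λ _ → negS X) A ⟩
    det N (Schur m)
  ≈⟨ det-Schur m ⟩
    det m (IplusXB m)
  ≈⟨ Qneg≗det m ⟨
    Qneg m ∎
  where
  open import Relation.Binary.Reasoning.Setoid R.setoid
  N : ℕ
  N = suc m
  A : Fin N → Fin N → Series
  A = IminusXB N
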